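{- Let $p$ and $n$ be positive integers. The set of $p$-Fibonacci words of length $n$ is in bijection with the set of binary words of length $n-1$ (over $\{0,1\}$) that do not contain $p$ consecutive occurrences of the symbol $1$.
   Context: A $p$-Fibonacci word of length $n\ge 1$ is a word $u=u_1u_2\cdots u_n$ over $\{1,\dots,p\}$ with $u_1=p$ and, for $1\le i\le n-1$: if $u_i=1$ then $u_{i+1}=p$; if $2\le u_i\le p$ then $u_{i+1}\in\{u_i-1,\,p\}$. -}

module Defs where

open import Data.Nat using (ℕ; zero; suc; _+_; _≡ᵇ_)
open import Data.Bool using (Bool; true; false; _∧_; _∨_; T)
open import Data.Fin using (Fin; toℕ)
open import Data.Vec using (Vec; []; _∷_)
open import Data.Product using (Σ)

-- Letters of the alphabet {1,…,p} are represented by Fin p: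
-- the element i : Fin p stands for the letter  toℕ i + 1.
letter : {p : ℕ} → Fin p → ℕ
letter i = suc (toℕ i)

-- Transition rule u_i → u_{i+1} (Boolean, so that T (…) is proof-irrelevant):
--  if u_i = 1 then u_{i+1} = p;
--  if 2 ≤ u_i ≤ p then u_{i+1} ∈ {u_i - 1, p}.
fibStep : (p : ℕ) → Fin p → Fin p → Bool
fibStep p a b with letter a
... | suc zero = letter b ≡ᵇ p
... | suc (suc k) = (letter b ≡ᵇ suc k) ∨ (letter b ≡ᵇ p)
... | zero = false

fibSteps : (p : ℕ) {n : ℕ} → Vec (Fin p) n → Bool
fibSteps p [] = true
fibSteps p (a ∷ []) = true
fibSteps p (a ∷ b ∷ w) = fibStep p a b ∧ fibSteps p (b ∷ w)

isFibWord : (p : ℕ) {n : ℕ} → Vec (Fin p) n → Bool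
isFibWord p [] = false
isFibWord p (a ∷ w) = (letter a ≡ᵇ p) ∧ fibSteps p (a ∷ w)

FibWord : (p n : ℕ) → Set
FibWord p n = Σ (Vec (Fin p) n) (λ u → T (isFibWord p u))

-- Checks that a binary word contains no p consecutive 1s;
-- r = length of the current run of trailing 1s.
noRunFrom : (p r : ℕ) {n : ℕ} → Vec Bool n → Bool
noRunFrom p r [] = true
noRunFrom p r (false ∷ w) = noRunFrom p 0 w
noRunFrom p r (true ∷ w) with suc r ≡ᵇ p
... | true = false
... | false = noRunFrom p (suc r) w

-- Binary words (false = 0, true = 1) of length m with no factor 1^p.
NoRunWord : (p m : ℕ) → Set
NoRunWord p m = Σ (Vec Bool m) (λ w → T (noRunFrom p 0 w))

{-# OPTIONS --safe #-}
module Submission where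

-- Each letter of a p-Fibonacci word after the first is either p (a reset, recorded as 0) or
-- one less than its predecessor (a decrement, recorded as 1); since a decrement never lands
-- on p, the bits determine the word, which is rebuilt by following them from the letter p.
-- After r consecutive 1s the letter is p − r, so the rule that the letter 1 must be followed
-- by p says exactly that no p consecutive 1s occur.

open import Defs
open import Data.Nat using (ℕ; suc; _+_; _≡ᵇ_)
open import Data.Nat.Properties using (≡ᵇ⇒≡; ≡⇒≡ᵇ; +-identityʳ; +-suc; m+1+n≢n; suc-injective)
open import Data.Bool using (Bool; true; false; not; T)
open import Data.Bool.Properties using (T-∧; T-∨; T-irrelevant)
open import Data.Fin using (Fin; toℕ; fromℕ; inject₁; pred; _≟_) renaming (zero to fz; suc to fs)
open import Data.Fin.Properties using (toℕ-injective; toℕ-fromℕ; toℕ-inject₁; fromℕ≢inject₁)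
open import Data.Vec using (Vec; []; _∷_; map)
open import Data.Product using (_×_; _,_)
open import Data.Product.Properties using (Σ-≡,≡→≡)
open import Data.Sum using (inj₁; inj₂)
open import Data.Empty using (⊥-elim)
open import Function using (Equivalence; _∘_)
open import Function.Bundles using (_⤖_; mk↔ₛ′)
open import Function.Properties.Inverse using (↔⇒⤖)
open import Relation.Nullary using (¬_; does)
open import Relation.Nullary.Decidable using (dec-true; dec-false)
open import Relation.Binary.PropositionalEquality using (_≡_; _≢_; refl; sym; trans; cong; cong₂; subst)

open Equivalence using (to; from)

noRunFrom-∷true-≡ : ∀ {P n} r (w : Vec Bool n) → suc r ≡ P → noRunFrom P r (true ∷ w) ≡ false
noRunFrom-∷true-≡ r w refl with suc r ≡ᵇ suc r in eq
... | true = refl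
... | false = ⊥-elim (subst T eq (≡⇒≡ᵇ r r refl))

noRunFrom-∷true-≢ : ∀ {P n} r (w : Vec Bool n) → suc r ≢ P → noRunFrom P r (true ∷ w) ≡ noRunFrom P (suc r) w
noRunFrom-∷true-≢ {P} r w r+1≢P with suc r ≡ᵇ P in eq
... | true = ⊥-elim (r+1≢P (≡ᵇ⇒≡ (suc r) P (subst T (sym eq) _)))
... | false = refl

module Encoding (p : ℕ) where

  top : Fin (suc p)
  top = fromℕ p

  data Step : Fin (suc p) → Fin (suc p) → Set where
    reset : ∀ {a} → Step a top
    decrement : ∀ {i} → Step (fs i) (inject₁ i)

  top≡ᵇp : T (toℕ top ≡ᵇ p)
  top≡ᵇp = ≡⇒≡ᵇ (toℕ top) p (toℕ-fromℕ p)

  toℕ≡ᵇp⇒top : ∀ (b : Fin (suc p)) → T (toℕ b ≡ᵇ p) → b ≡ top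
  toℕ≡ᵇp⇒top b h = toℕ-injective (trans (≡ᵇ⇒≡ (toℕ b) p h) (sym (toℕ-fromℕ p)))

  fibStep-sound : ∀ {a b} → Step a b → T (fibStep (suc p) a b)
  fibStep-sound {fz} reset = top≡ᵇp
  fibStep-sound {fs i} reset = from T-∨ (inj₂ top≡ᵇp)
  fibStep-sound (decrement {i}) = from T-∨ (inj₁ (≡⇒≡ᵇ _ _ (toℕ-inject₁ i)))

  fibStep-complete : ∀ a b → T (fibStep (suc p) a b) → Step a b
  fibStep-complete fz b h with toℕ≡ᵇp⇒top b h
  ... | refl = reset
  fibStep-complete (fs i) b h with to T-∨ h
  ... | inj₂ b≡p with toℕ≡ᵇp⇒top b b≡p
  ...   | refl = reset
  fibStep-complete (fs i) b h | inj₁ b≡i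
    with toℕ-injective {i = b} {j = inject₁ i} (trans (≡ᵇ⇒≡ _ _ b≡i) (sym (toℕ-inject₁ i)))
  ...   | refl = decrement

  fibSteps-∷ : ∀ {n} a b (u : Vec (Fin (suc p)) n) →
               T (fibSteps (suc p) (a ∷ b ∷ u)) → Step a b × T (fibSteps (suc p) (b ∷ u))
  fibSteps-∷ a b u h with to T-∧ h
  ... | step , steps = fibStep-complete a b step , steps

  bit : Fin (suc p) → Bool
  bit b = not (does (b ≟ top))

  bit-top : bit top ≡ false
  bit-top = cong not (dec-true (top ≟ top) refl)

  bit-inject₁ : ∀ i → bit (inject₁ i) ≡ true
  bit-inject₁ i = cong not (dec-false (inject₁ i ≟ top) (fromℕ≢inject₁ ∘ sym))

  -- pred fz = fz is junk: from the top letter, a 1 read at fz would complete a run of suc p 1s.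
  next : Fin (suc p) → Bool → Fin (suc p)
  next a false = top
  next a true = pred a

  next-bit : ∀ {a b} → Step a b → next a (bit b) ≡ b
  next-bit reset rewrite bit-top = refl
  next-bit (decrement {i}) rewrite bit-inject₁ i = refl

  encode : ∀ {n} → Vec (Fin (suc p)) n → Vec Bool n
  encode = map bit

  decode : ∀ {n} → Fin (suc p) → Vec Bool n → Vec (Fin (suc p)) n
  decode a [] = []
  decode a (x ∷ w) = next a x ∷ decode (next a x) w

  -- a is the letter reached from the top letter by r consecutive decrements.
  Run : ℕ → Fin (suc p) → Set
  Run r a = toℕ a + r ≡ p

  run-reset : Run 0 top
  run-reset = trans (+-identityʳ (toℕ top)) (toℕ-fromℕ p)

  run-decrement : ∀ {r i} → Run r (fs i) → Run (suc r) (inject₁ i)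
  run-decrement {r} {i} run rewrite toℕ-inject₁ i = trans (+-suc (toℕ i) r) run

  run-unfinished : ∀ {r i} → Run r (fs i) → suc r ≢ suc p
  run-unfinished {r} {i} run r+1≡p+1 =
    m+1+n≢n (toℕ i) (trans (+-suc (toℕ i) r) (trans run (sym (suc-injective r+1≡p+1))))

  run-continues : ∀ {n r i} (w : Vec Bool n) → Run r (fs i) →
                  noRunFrom (suc p) r (true ∷ w) ≡ noRunFrom (suc p) (suc r) w
  run-continues {r = r} w run = noRunFrom-∷true-≢ r w (run-unfinished run)

  run-exhausted : ∀ {n r} (w : Vec Bool n) → Run r fz → ¬ T (noRunFrom (suc p) r (true ∷ w))
  run-exhausted w refl = subst T (noRunFrom-∷true-≡ p w refl)

  decode-valid : ∀ {n r} a (w : Vec Bool n) → Run r a →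
                 T (noRunFrom (suc p) r w) → T (fibSteps (suc p) (a ∷ decode a w))
  decode-valid a [] _ _ = _
  decode-valid a (false ∷ w) _ h = from T-∧ (fibStep-sound (reset {a}) , decode-valid top w run-reset h)
  decode-valid fz (true ∷ w) run h = ⊥-elim (run-exhausted w run h)
  decode-valid (fs i) (true ∷ w) run h =
    from T-∧ (fibStep-sound (decrement {i}) ,
              decode-valid (inject₁ i) w (run-decrement run) (subst T (run-continues w run) h))

  encode-decode : ∀ {n r} a (w : Vec Bool n) → Run r a →
                  T (noRunFrom (suc p) r w) → encode (decode a w) ≡ w
  encode-decode a [] _ _ = refl
  encode-decode a (false ∷ w) _ h = cong₂ _∷_ bit-top (encode-decode top w run-reset h)
  encode-decode fz (true ∷ w) run h = ⊥-elim (run-exhausted w run h)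
  encode-decode (fs i) (true ∷ w) run h =
    cong₂ _∷_ (bit-inject₁ i)
              (encode-decode (inject₁ i) w (run-decrement run) (subst T (run-continues w run) h))

  encode-valid : ∀ {n r} a (u : Vec (Fin (suc p)) n) → Run r a →
                 T (fibSteps (suc p) (a ∷ u)) → T (noRunFrom (suc p) r (encode u))
  encode-valid a [] _ _ = _
  encode-valid a (b ∷ u) run h with fibSteps-∷ a b u h
  ... | reset , steps rewrite bit-top = encode-valid top u run-reset steps
  ... | decrement {i} , steps rewrite bit-inject₁ i =
    subst T (sym (run-continues (encode u) run)) (encode-valid (inject₁ i) u (run-decrement run) steps)

  decode-encode : ∀ {n} a (u : Vec (Fin (suc p)) n) → T (fibSteps (suc p) (a ∷ u)) → decode a (encode u) ≡ u
  decode-encode a [] _ = refl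
  decode-encode a (b ∷ u) h with fibSteps-∷ a b u h
  ... | step , steps rewrite next-bit step = cong (b ∷_) (decode-encode b u steps)

  isFibWord-∷ : ∀ {n} a (u : Vec (Fin (suc p)) n) →
                T (isFibWord (suc p) (a ∷ u)) → a ≡ top × T (fibSteps (suc p) (a ∷ u))
  isFibWord-∷ a u h with to T-∧ h
  ... | head , steps = toℕ≡ᵇp⇒top a head , steps

theorem4 : (p n : ℕ) → FibWord (suc p) (suc n) ⤖ NoRunWord (suc p) n
theorem4 p n = ↔⇒⤖ (mk↔ₛ′ toBinary toFibonacci toBinary∘toFibonacci toFibonacci∘toBinary)
  where
    open Encoding p

    toBinary : FibWord (suc p) (suc n) → NoRunWord (suc p) n
    toBinary (a ∷ u , h) =
      let a≡top , steps = isFibWord-∷ a u h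
      in encode u , encode-valid a u (subst (Run 0) (sym a≡top) run-reset) steps

    toFibonacci : NoRunWord (suc p) n → FibWord (suc p) (suc n)
    toFibonacci (w , h) = top ∷ decode top w , from T-∧ (top≡ᵇp , decode-valid top w run-reset h)

    toBinary∘toFibonacci : ∀ w → toBinary (toFibonacci w) ≡ w
    toBinary∘toFibonacci (w , h) = Σ-≡,≡→≡ (encode-decode top w run-reset h , T-irrelevant _ _)

    toFibonacci∘toBinary : ∀ u → toFibonacci (toBinary u) ≡ u
    toFibonacci∘toBinary (a ∷ u , h) with isFibWord-∷ a u h
    ... | refl , steps = Σ-≡,≡→≡ (cong (top ∷_) (decode-encode top u steps) , T-irrelevant _ _)
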